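{- Let $r\ge 2$ be an integer and let $G$ be a simple edge-colored graph with $n$ vertices and $n$ color classes, each of size at least $2$ and at most $r$. Let $R=X\cup\{u_1,\dots,u_m\}\subseteq V(G)$, let $M:=\{M_{u_i}: i\in[m]\}$ be a galaxy rooted at $\{u_1,\dots,u_m\}$, let $C_X\subseteq C(X)$, and let $x\in\mathbb{N}$ be such that (1) $V(M_{u_i})\setminus\{u_i\}\subseteq X\cup\{u_1,\dots,u_{i-1}\}$ for all $i\in[m]$; (2) $C_X\cap C(M)=\emptyset$; (3) for every pair of vertices $u,v\in X$, there exists a rainbow path in $G[X]$ from $u$ to $v$ of length at most $x$ consisting of colors in $C_X$. Then for every pair of vertices $u,v\in R$, there exists a rainbow path in $G[R]$ from $u$ to $v$ consisting of colors in $C_X\cup C(M)$ of length at most $$\frac{m+\sum_{i=1}^m (r-|u_i|_M)}{r}+x+2.$$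
   Context: An edge-colored graph is a (multi)graph whose edges are each assigned a color; a color class is the set of edges of a given color; $G$ is simple if no color class contains parallel edges. A subgraph is rainbow if no two of its edges have the same color. For $X\subseteq V(G)$, $G[X]$ is the induced subgraph and $C(X)$ is the set of colors appearing on edges of $G[X]$. For $U\subseteq V(G)$, a galaxy rooted at $U$ is a collection $M=\{M_u:u\in U\}$ of subgraphs of $G$ such that each $M_u$ is a star centred at $u$ with $|E(M_u)|\ge 1$ all of whose edges have the same color $c_u$, and $c_u\ne c_v$ for $u\ne v$. $C(M):=\{c_u:u\in U\}$ and $|u|_M:=|E(M_u)|$. -}

module Defs where

open import Data.Nat using (ℕ; zero; suc; _+_; _*_; _∸_; _≤_; _<_)
open import Data.Fin using (Fin; _≟_)
import Data.Fin as F
open import Data.Fin.Subset using (Subset; _∈_)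
open import Data.List using (List; []; _∷_; length; filter; map; head; last)
open import Data.List.Relation.Unary.All using (All)
open import Data.List.Relation.Unary.Unique.Propositional using (Unique)
open import Data.List.Membership.Propositional renaming (_∈_ to _∈ₗ_)
open import Data.Maybe using (just)
open import Data.Product using (_×_; _,_; proj₁; proj₂; ∃; ∃-syntax)
open import Data.Sum using (_⊎_)
open import Relation.Binary.PropositionalEquality using (_≡_; _≢_)
open import Relation.Nullary using (¬_)

sumFin : ∀ {m} → (Fin m → ℕ) → ℕ
sumFin {zero}  f = 0
sumFin {suc m} f = f F.zero + sumFin (λ i → f (F.suc i))

-- An edge-colored (multi)graph on vertex set Fin n with colors in Fin n.
-- Edges are indexed by Fin e; each edge has two (distinct) endpoints and a color.
record ECGraph (n : ℕ) : Set where
  field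
    e        : ℕ
    ends     : Fin e → Fin n × Fin n
    col      : Fin e → Fin n
    loopless : ∀ j → proj₁ (ends j) ≢ proj₂ (ends j)

module _ {n : ℕ} (G : ECGraph n) where
  open ECGraph G

  Joins : Fin e → Fin n → Fin n → Set
  Joins j a b = ends j ≡ (a , b) ⊎ ends j ≡ (b , a)

  Parallel : Fin e → Fin e → Set
  Parallel j k = Joins k (proj₁ (ends j)) (proj₂ (ends j))

  Simple : Set
  Simple = ∀ j k → j ≢ k → col j ≡ col k → ¬ Parallel j k

  classSize : Fin n → ℕ
  classSize c = length (filter (λ j → col j ≟ c) (Data.List.tabulate (λ j → j)))
    where import Data.List

  InC : Subset n → Fin n → Set
  InC X c = ∃[ j ] (col j ≡ c × proj₁ (ends j) ∈ X × proj₂ (ends j) ∈ X)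

  data Trail : List (Fin n) → List (Fin e) → Set where
    single : ∀ v → Trail (v ∷ []) []
    step   : ∀ {u v vs es} (j : Fin e) → Joins j u v →
             Trail (v ∷ vs) es → Trail (u ∷ v ∷ vs) (j ∷ es)

  record RainbowPath (InV : Fin n → Set) (InCol : Fin n → Set)
                     (a b : Fin n) (ℓ : ℕ) : Set where
    field
      verts    : List (Fin n)
      edges    : List (Fin e)
      trail    : Trail verts edges
      start    : head verts ≡ just a
      finish   : last verts ≡ just b
      path     : Unique verts
      rainbow  : Unique (map col edges)
      inside   : All InV verts
      colsOK   : All (λ j → InCol (col j)) edges
      len      : length edges ≡ ℓ

  record Galaxy {m : ℕ} (u : Fin m → Fin n) : Set where
    field
      star       : Fin m → List (Fin e)
      c          : Fin m → Fin n
      nonempty   : ∀ i → 1 ≤ length (star i)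
      distinctE  : ∀ i → Unique (star i)
      centred    : ∀ i → All (λ j → ∃[ w ] Joins j (u i) w) (star i)
      monochrome : ∀ i → All (λ j → col j ≡ c i) (star i)
      distinctC  : ∀ i k → i ≢ k → c i ≢ c k

    deg : Fin m → ℕ
    deg i = length (star i)

    InCM : Fin n → Set
    InCM d = ∃[ i ] c i ≡ d

{-# OPTIONS --safe #-}
module Submission where

-- Strengthen the claim to sets and induct on k. Let R_k = X ∪ {u_i : i < k}. For all
-- S, W ⊆ R_k with 1 ≤ |S|, |W| ≤ r there are s ∈ S, w ∈ W and a rainbow s–w path in G[R_k]
-- with colours in C_X ∪ {c_i : i < k} whose length ℓ satisfies
--   r ℓ + |S| + |W| ≤ r (x + 2) + 2 + Σ_{i<k} (1 + r − |u_i|_M).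
-- For k = 0 this is (3). When u_k joins, the only new case is that u_k lies in exactly one
-- of the sets, say S. If |S| ≥ 2, drop u_k from S; the sum grows by at least 1. If S = {u_k},
-- replace S by a set N of up to r star neighbours of u_k: distinct as G is simple, they lie in
-- R_k by (1), and the star colour is unused in R_k by (2) and since galaxy colours differ.
-- Prepending the star edge costs r, which |N| + (r − |u_k|_M) ≥ r pays for.
-- The theorem is the case S = {a}, W = {b}, k = m.

open import Defs
open import Data.Nat using (ℕ; zero; suc; _+_; _*_; _∸_; _≤_; _≥_; _⊓_; _<ᵇ_; z≤n; s≤s; _≤?_)
  renaming (_<_ to _<ℕ_)
open import Data.Nat.Properties
open import Data.Nat.Tactic.RingSolver using (solve-∀)
open import Data.Bool using (if_then_else_)
open import Function using (_∘_; id)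
open import Data.Fin using (Fin; _<_; toℕ; fromℕ<) renaming (zero to fzero; suc to fsuc)
import Data.Fin as Fin
open import Data.Fin.Properties using (toℕ-injective; toℕ<n; toℕ-fromℕ<)
open import Data.Fin.Subset using (Subset; _∈_; _∉_)
open import Data.Fin.Subset.Properties using (_∈?_)
open import Data.List using (List; []; _∷_; _∷ʳ_; length; map; take; head; last)
open import Data.List.Properties using (map-++; length-++; length-take)
open import Data.List.Membership.Propositional renaming (_∈_ to _∈ₗ_; _∉_ to _∉ₗ_)
import Data.List.Membership.DecPropositional as DecMembership
open import Data.List.Relation.Unary.All using (All; []; _∷_)
import Data.List.Relation.Unary.All as All
import Data.List.Relation.Unary.All.Properties as All
open import Data.List.Relation.Unary.AllPairs using ([]; _∷_)
open import Data.List.Relation.Unary.Any using (here; there)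
open import Data.List.Relation.Unary.Unique.Propositional using (Unique)
import Data.List.Relation.Unary.Unique.Propositional.Properties as Unique
open import Data.Maybe using (just)
open import Data.Product using (Σ; _×_; _,_; proj₁; proj₂; ∃-syntax)
open import Data.Sum using (_⊎_; inj₁; inj₂; swap)
open import Data.Empty using (⊥-elim)
open import Relation.Nullary using (¬_; yes; no)
open import Relation.Unary using (Pred; ｛_｝; _∪_)
open import Relation.Binary.PropositionalEquality
  using (_≡_; _≢_; refl; sym; trans; cong; subst; module ≡-Reasoning)

module _ {A : Set} where

  last-∷ʳ : ∀ (xs : List A) z → last (xs ∷ʳ z) ≡ just z
  last-∷ʳ []           z = refl
  last-∷ʳ (x ∷ [])     z = refl
  last-∷ʳ (x ∷ y ∷ xs) z = last-∷ʳ (y ∷ xs) z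

  Unique-∷ʳ : ∀ {xs : List A} {z} → Unique xs → z ∉ₗ xs → Unique (xs ∷ʳ z)
  Unique-∷ʳ uxs z∉xs = Unique.++⁺ uxs ([] ∷ []) λ { (v∈xs , here refl) → z∉xs v∈xs }

  Unique-remove : ∀ {xs : List A} {z} → Unique xs → z ∈ₗ xs →
    Σ (List A) λ ys → Unique ys × length xs ≡ suc (length ys) ×
      (∀ {v} → v ∈ₗ ys → v ∈ₗ xs × v ≢ z)
  Unique-remove (x∉xs ∷ uxs) (here refl) =
    _ , uxs , refl , λ v∈ → there v∈ , λ { refl → All.lookup x∉xs v∈ refl }
  Unique-remove {x ∷ _} (x∉xs ∷ uxs) (there z∈xs) with Unique-remove uxs z∈xs
  ... | ys , uys , len , sub =
    x ∷ ys , All.tabulate (λ v∈ → All.lookup x∉xs (proj₁ (sub v∈))) ∷ uys , cong suc len ,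
    λ { (here refl) → here refl , λ { refl → All.lookup x∉xs z∈xs refl }
      ; (there v∈) → there (proj₁ (sub v∈)) , proj₂ (sub v∈) }

  length-take-cover : ∀ k (xs : List A) → k ≤ length (take k xs) + (k ∸ length xs)
  length-take-cover k xs = ≤-reflexive (sym (begin
    length (take k xs) + (k ∸ length xs) ≡⟨ cong (_+ (k ∸ length xs)) (length-take k xs) ⟩
    k ⊓ length xs + (k ∸ length xs)      ≡⟨ cong (_+ (k ∸ length xs)) (⊓-comm k (length xs)) ⟩
    length xs ⊓ k + (k ∸ length xs)      ≡⟨ m⊓n+n∸m≡n (length xs) k ⟩
    k                                    ∎))
    where open ≡-Reasoning

sumBelow : ∀ {m} → ℕ → (Fin m → ℕ) → ℕ
sumBelow k f = sumFin (λ i → if toℕ i <ᵇ k then f i else 0)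

sumFin-zero : ∀ {m} → sumFin {m} (λ _ → 0) ≡ 0
sumFin-zero {zero}  = refl
sumFin-zero {suc m} = sumFin-zero {m}

sumBelow-suc : ∀ {m} (f : Fin m → ℕ) i → sumBelow (suc (toℕ i)) f ≡ sumBelow (toℕ i) f + f i
sumBelow-suc {suc m} f fzero = begin
  f fzero + sumFin {m} (λ _ → 0)       ≡⟨ cong (f fzero +_) (sumFin-zero {m}) ⟩
  f fzero + 0                          ≡⟨ +-comm (f fzero) 0 ⟩
  0 + f fzero                          ≡⟨ cong (_+ f fzero) (sym (sumFin-zero {m})) ⟩
  sumFin {m} (λ _ → 0) + f fzero       ∎
  where open ≡-Reasoning
sumBelow-suc {suc m} f (fsuc i) = begin
  f fzero + sumBelow (suc (toℕ i)) (f ∘ fsuc)        ≡⟨ cong (f fzero +_) (sumBelow-suc (f ∘ fsuc) i) ⟩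
  f fzero + (sumBelow (toℕ i) (f ∘ fsuc) + f (fsuc i)) ≡⟨ +-assoc (f fzero) _ _ ⟨
  f fzero + sumBelow (toℕ i) (f ∘ fsuc) + f (fsuc i)   ∎
  where open ≡-Reasoning

sumBelow-all : ∀ {m} (f : Fin m → ℕ) → sumBelow m f ≡ sumFin f
sumBelow-all {zero}  f = refl
sumBelow-all {suc m} f = cong (f fzero +_) (sumBelow-all (λ i → f (fsuc i)))

sumFin-suc : ∀ {m} (f : Fin m → ℕ) → sumFin (λ i → suc (f i)) ≡ m + sumFin f
sumFin-suc {zero}  f = refl
sumFin-suc {suc m} f = cong suc (begin
  f fzero + sumFin (λ i → suc (f (fsuc i)))  ≡⟨ cong (f fzero +_) (sumFin-suc (λ i → f (fsuc i))) ⟩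
  f fzero + (m + sumFin (λ i → f (fsuc i)))  ≡⟨ +-left-comm (f fzero) m _ ⟩
  m + (f fzero + sumFin (λ i → f (fsuc i)))  ∎)
  where
  open ≡-Reasoning
  +-left-comm : ∀ a b c → a + (b + c) ≡ b + (a + c)
  +-left-comm = solve-∀

module _ {n} {G : ECGraph n} where
  open ECGraph G

  Joins-parallel : ∀ {j j′ a b} → Joins G j a b → Joins G j′ a b → Parallel G j j′
  Joins-parallel (inj₁ refl) jo′ = jo′
  Joins-parallel (inj₂ refl) jo′ = swap jo′

  RainbowPath-map : ∀ {InV InV′ InCol InCol′ : Pred (Fin n) _} {a b ℓ} →
    (∀ {v} → InV v → InV′ v) → (∀ {d} → InCol d → InCol′ d) →
    RainbowPath G InV InCol a b ℓ → RainbowPath G InV′ InCol′ a b ℓ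
  RainbowPath-map f g p = record
    { verts = verts ; edges = edges ; trail = trail ; start = start ; finish = finish
    ; path = path ; rainbow = rainbow ; inside = All.map f inside
    ; colsOK = All.map g colsOK ; len = len }
    where open RainbowPath p

  RainbowPath-trivial : ∀ {InV InCol : Pred (Fin n) _} {a} → InV a → RainbowPath G InV InCol a a 0
  RainbowPath-trivial a∈ = record
    { verts = _ ∷ [] ; edges = [] ; trail = single _ ; start = refl ; finish = refl
    ; path = [] ∷ [] ; rainbow = [] ; inside = a∈ ∷ [] ; colsOK = [] ; len = refl }

  module _ {InV InCol : Pred (Fin n) _} {a b ℓ z j}
           (z∉V : ¬ InV z) (colj∉ : ¬ InCol (col j)) (p : RainbowPath G InV InCol a b ℓ) where
    open RainbowPath p

    private
      z∉verts : z ∉ₗ verts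
      z∉verts z∈ = z∉V (All.lookup inside z∈)

      colj∉cols : col j ∉ₗ map col edges
      colj∉cols colj∈ = colj∉ (All.lookup {P = InCol} (All.map⁺ colsOK) colj∈)

    RainbowPath-∷ : Joins G j z a →
      RainbowPath G (｛ z ｝ ∪ InV) (｛ col j ｝ ∪ InCol) z b (suc ℓ)
    RainbowPath-∷ jo = record
      { verts = z ∷ verts ; edges = j ∷ edges ; trail = cons trail start
      ; start = refl ; finish = finish′ trail finish
      ; path = All.tabulate (λ { v∈ refl → z∉verts v∈ }) ∷ path
      ; rainbow = All.tabulate (λ { c∈ refl → colj∉cols c∈ }) ∷ rainbow
      ; inside = inj₁ refl ∷ All.map inj₂ inside
      ; colsOK = inj₁ refl ∷ All.map inj₂ colsOK
      ; len = cong suc len }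
      where
      cons : ∀ {vs es} → Trail G vs es → head vs ≡ just a → Trail G (z ∷ vs) (j ∷ es)
      cons t@(single _)   refl = step j jo t
      cons t@(step _ _ _) refl = step j jo t
      finish′ : ∀ {vs es} → Trail G vs es → last vs ≡ just b → last (z ∷ vs) ≡ just b
      finish′ (single _)   eq = eq
      finish′ (step _ _ _) eq = eq

    RainbowPath-∷ʳ : Joins G j b z →
      RainbowPath G (｛ z ｝ ∪ InV) (｛ col j ｝ ∪ InCol) a z (suc ℓ)
    RainbowPath-∷ʳ jo = record
      { verts = verts ∷ʳ z ; edges = edges ∷ʳ j ; trail = snoc trail finish jo
      ; start = start′ trail start ; finish = last-∷ʳ verts z
      ; path = Unique-∷ʳ path z∉verts
      ; rainbow = subst Unique (sym (map-++ col edges (j ∷ []))) (Unique-∷ʳ rainbow colj∉cols)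
      ; inside = All.∷ʳ⁺ (All.map inj₂ inside) (inj₁ refl)
      ; colsOK = All.∷ʳ⁺ (All.map inj₂ colsOK) (inj₁ refl)
      ; len = trans (length-++ edges) (trans (+-comm (length edges) 1) (cong suc len)) }
      where
      snoc : ∀ {vs es b′} → Trail G vs es → last vs ≡ just b′ → Joins G j b′ z →
             Trail G (vs ∷ʳ z) (es ∷ʳ j)
      snoc (single _)     refl jo′ = step j jo′ (single z)
      snoc (step j′ jo′ t) eq  jo″ = step j′ jo′ (snoc t eq jo″)
      start′ : ∀ {vs es} → Trail G vs es → head vs ≡ just a → head (vs ∷ʳ z) ≡ just a
      start′ (single _)   eq = eq
      start′ (step _ _ _) eq = eq

  record Neighbours (z : Fin n) (js : List (Fin e)) : Set where
    field
      list     : List (Fin n)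
      distinct : Unique list
      count    : length list ≡ length js
      via      : All (λ w → ∃[ j ] (j ∈ₗ js × Joins G j z w)) list

  monochromatic-star-neighbours : Simple G → ∀ z d (js : List (Fin e)) → Unique js →
    All (λ j → ∃[ w ] Joins G j z w) js → All (λ j → col j ≡ d) js → Neighbours z js
  monochromatic-star-neighbours simple z d [] _ _ _ = record
    { list = [] ; distinct = [] ; count = refl ; via = [] }
  monochromatic-star-neighbours simple z d (j ∷ js) (j∉js ∷ ujs) ((w , jo) ∷ centred)
    (colj ∷ mono) = record
      { list = w ∷ list
      ; distinct = All.map w-new via ∷ distinct
      ; count = cong suc count
      ; via = (j , here refl , jo) ∷ All.map (λ { (j′ , j′∈ , jo′) → j′ , there j′∈ , jo′ }) via }
    where
    open Neighbours (monochromatic-star-neighbours simple z d js ujs centred mono)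
    w-new : ∀ {w′} → ∃[ j′ ] (j′ ∈ₗ js × Joins G j′ z w′) → w ≢ w′
    w-new (j′ , j′∈ , jo′) refl =
      simple j j′ (All.lookup j∉js j′∈) (trans colj (sym (All.lookup mono j′∈)))
        (Joins-parallel jo jo′)

prepend-cost : ∀ {r ℓ N D A B T} → r ≤ N + D → A ≤ 1 →
  r * ℓ + (N + B) ≤ T → r * suc ℓ + (A + B) ≤ T + suc D
prepend-cost {r} {ℓ} {N} {D} {A} {B} {T} r≤N+D A≤1 cost = begin
  r * suc ℓ + (A + B)        ≡⟨ cong (_+ (A + B)) (*-suc r ℓ) ⟩
  r + r * ℓ + (A + B)        ≤⟨ +-mono-≤ (+-monoˡ-≤ (r * ℓ) r≤N+D) (+-monoˡ-≤ B A≤1) ⟩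
  N + D + r * ℓ + (1 + B)    ≡⟨ regroup N D (r * ℓ) B ⟩
  r * ℓ + (N + B) + suc D    ≤⟨ +-monoˡ-≤ (suc D) cost ⟩
  T + suc D                  ∎
  where
  open ≤-Reasoning
  regroup : ∀ N D a B → N + D + a + (1 + B) ≡ a + (N + B) + suc D
  regroup = solve-∀

append-cost : ∀ {r ℓ N D A B T} → r ≤ N + D → B ≤ 1 →
  r * ℓ + (A + N) ≤ T → r * suc ℓ + (A + B) ≤ T + suc D
append-cost {r} {ℓ} {N} {D} {A} {B} {T} r≤N+D B≤1 cost =
  subst (λ t → r * suc ℓ + t ≤ T + suc D) (+-comm B A)
    (prepend-cost r≤N+D B≤1 (subst (λ t → r * ℓ + t ≤ T) (+-comm A N) cost))

module Linkage (r : ℕ) (r≥2 : r ≥ 2) (n : ℕ) (G : ECGraph n) (simple : Simple G)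
  (X : Subset n) (m : ℕ) (u : Fin m → Fin n) (u-injective : ∀ i k → u i ≡ u k → i ≡ k)
  (M : Galaxy G u) (CX : Subset n) (x : ℕ)
  (star-earlier : ∀ i j w → j ∈ₗ Galaxy.star M i → Joins G j (u i) w →
     w ∈ X ⊎ ∃[ k ] (k < i × w ≡ u k))
  (CX-fresh : ∀ c → c ∈ CX → ¬ Galaxy.InCM M c)
  (X-linked : ∀ a b → a ∈ X → b ∈ X →
     ∃[ ℓ ] (ℓ ≤ x × RainbowPath G (_∈ X) (_∈ CX) a b ℓ)) where

  open ECGraph G
  open Galaxy M

  InR< : ℕ → Fin n → Set
  InR< k v = v ∈ X ⊎ ∃[ i ] (toℕ i <ℕ k × v ≡ u i)

  InC< : ℕ → Fin n → Set
  InC< k d = d ∈ CX ⊎ ∃[ i ] (toℕ i <ℕ k × c i ≡ d)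

  InR<-suc : ∀ {k v} → InR< k v → InR< (suc k) v
  InR<-suc (inj₁ v∈X)          = inj₁ v∈X
  InR<-suc (inj₂ (i , i<k , eq)) = inj₂ (i , m<n⇒m<1+n i<k , eq)

  InC<-suc : ∀ {k d} → InC< k d → InC< (suc k) d
  InC<-suc (inj₁ d∈CX)         = inj₁ d∈CX
  InC<-suc (inj₂ (i , i<k , eq)) = inj₂ (i , m<n⇒m<1+n i<k , eq)

  weight : Fin m → ℕ
  weight i = suc (r ∸ deg i)

  budget : ℕ → ℕ
  budget k = r * (x + 2) + 2 + sumBelow k weight

  budget-suc : ∀ i → budget (suc (toℕ i)) ≡ budget (toℕ i) + weight i
  budget-suc i = trans (cong (r * (x + 2) + 2 +_) (sumBelow-suc weight i))
    (sym (+-assoc (r * (x + 2) + 2) (sumBelow (toℕ i) weight) (weight i)))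

  within-budget : ∀ {ℓ A B} k → ℓ ≤ x → A ≤ r → B ≤ r → r * ℓ + (A + B) ≤ budget k
  within-budget {ℓ} {A} {B} k ℓ≤x A≤r B≤r = begin
    r * ℓ + (A + B)         ≤⟨ +-mono-≤ (*-monoʳ-≤ r ℓ≤x) (+-mono-≤ A≤r B≤r) ⟩
    r * x + (r + r)         ≡⟨ double r x ⟩
    r * (x + 2)             ≤⟨ m≤m+n _ 2 ⟩
    r * (x + 2) + 2         ≤⟨ m≤m+n _ _ ⟩
    budget k                ∎
    where
    open ≤-Reasoning
    double : ∀ r x → r * x + (r + r) ≡ r * (x + 2)
    double = solve-∀

  record Terminals (k : ℕ) : Set where
    field
      elems    : List (Fin n)
      distinct : Unique elems
      ⊆R       : All (InR< k) elems
      size≥1   : 1 ≤ length elems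
      size≤r   : length elems ≤ r
  open Terminals

  restrict : ∀ {k k′} (S : Terminals k′) → (∀ {v} → v ∈ₗ elems S → InR< k v) → Terminals k
  restrict S ⊆R<k = record
    { elems = elems S ; distinct = distinct S ; ⊆R = All.tabulate ⊆R<k
    ; size≥1 = size≥1 S ; size≤r = size≤r S }

  some-terminal : ∀ {k} (S : Terminals k) → ∃[ s ] s ∈ₗ elems S
  some-terminal S with elems S | size≥1 S
  ... | s ∷ _ | _ = s , here refl

  record Link (k : ℕ) (S W : List (Fin n)) : Set where
    constructor link
    field
      {s w}  : Fin n
      {ℓ}    : ℕ
      s∈S    : s ∈ₗ S
      w∈W    : w ∈ₗ W
      cost   : r * ℓ + (length S + length W) ≤ budget k
      path   : RainbowPath G (InR< k) (InC< k) s w ℓ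

  Linked : ℕ → Set
  Linked k = (S W : Terminals k) → Link k (elems S) (elems W)

  InR<-zero : ∀ {v} → InR< 0 v → v ∈ X
  InR<-zero (inj₁ v∈X) = v∈X

  linked-0 : Linked 0
  linked-0 S W with some-terminal S | some-terminal W
  ... | s , s∈S | w , w∈W
      with X-linked s w (InR<-zero (All.lookup (⊆R S) s∈S)) (InR<-zero (All.lookup (⊆R W) w∈W))
  ... | ℓ , ℓ≤x , p =
    link s∈S w∈W (within-budget 0 ℓ≤x (size≤r S) (size≤r W)) (RainbowPath-map inj₁ inj₁ p)

  module Step (i : Fin m) (ih : Linked (toℕ i)) where

    k : ℕ
    k = toℕ i

    z : Fin n
    z = u i

    z∈R : InR< (suc k) z
    z∈R = inj₂ (i , ≤-refl , refl)

    z∉R : z ∉ X → ¬ InR< k z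
    z∉R z∉X (inj₁ z∈X)            = z∉X z∈X
    z∉R z∉X (inj₂ (i′ , i′<k , eq)) = <-irrefl (cong toℕ (u-injective i′ i (sym eq))) i′<k

    ci∉C : ¬ InC< k (c i)
    ci∉C (inj₁ ci∈CX)            = CX-fresh (c i) ci∈CX (i , refl)
    ci∉C (inj₂ (i′ , i′<k , eq)) = distinctC i′ i (λ { refl → <-irrefl refl i′<k }) eq

    InR<-pred : ∀ {v} → InR< (suc k) v → v ≢ z → InR< k v
    InR<-pred (inj₁ v∈X) _ = inj₁ v∈X
    InR<-pred (inj₂ (i′ , i′<k+1 , refl)) v≢z with m≤n⇒m<n∨m≡n (≤-pred i′<k+1)
    ... | inj₁ i′<k = inj₂ (i′ , i′<k , refl)
    ... | inj₂ i′≡k = ⊥-elim (v≢z (cong u (toℕ-injective i′≡k)))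

    InR<-pred-X : z ∈ X → ∀ {v} → InR< (suc k) v → InR< k v
    InR<-pred-X z∈X {v} v∈R with v Fin.≟ z
    ... | yes refl = inj₁ z∈X
    ... | no v≢z   = InR<-pred v∈R v≢z

    without-z : (S : Terminals (suc k)) → z ∉ₗ elems S → Terminals k
    without-z S z∉S = restrict S λ v∈S → InR<-pred (All.lookup (⊆R S) v∈S) λ { refl → z∉S v∈S }

    drop-z : (S : Terminals (suc k)) → z ∈ₗ elems S → 2 ≤ length (elems S) →
      Σ (Terminals k) λ S′ → (∀ {v} → v ∈ₗ elems S′ → v ∈ₗ elems S) ×
        length (elems S) ≡ suc (length (elems S′))
    drop-z S z∈S 2≤|S| with Unique-remove (distinct S) z∈S
    ... | S′ , uS′ , |S|≡ , sub = record
      { elems = S′ ; distinct = uS′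
      ; ⊆R = All.tabulate λ v∈ → InR<-pred (All.lookup (⊆R S) (proj₁ (sub v∈))) (proj₂ (sub v∈))
      ; size≥1 = ≤-pred (subst (2 ≤_) |S|≡ 2≤|S|)
      ; size≤r = ≤-trans (n≤1+n _) (subst (_≤ r) |S|≡ (size≤r S)) }
      , proj₁ ∘ sub , |S|≡

    ≤budget-suc : ∀ {a} → a ≤ budget k + weight i → a ≤ budget (suc k)
    ≤budget-suc a≤ = ≤-trans a≤ (≤-reflexive (sym (budget-suc i)))

    Link-lift : ∀ {S W S′ W′} → Link k S′ W′ →
      (∀ {v} → v ∈ₗ S′ → v ∈ₗ S) → (∀ {v} → v ∈ₗ W′ → v ∈ₗ W) →
      length S + length W ≤ length S′ + length W′ + weight i → Link (suc k) S W
    Link-lift {S} {W} {S′} {W′} (link {ℓ = ℓ} s∈ w∈ cost p) S′⊆S W′⊆W sizes =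
      link (S′⊆S s∈) (W′⊆W w∈) (≤budget-suc cost′) (RainbowPath-map InR<-suc InC<-suc p)
      where
      open ≤-Reasoning
      cost′ : r * ℓ + (length S + length W) ≤ budget k + weight i
      cost′ = begin
        r * ℓ + (length S + length W)                   ≤⟨ +-monoʳ-≤ (r * ℓ) sizes ⟩
        r * ℓ + (length S′ + length W′ + weight i)      ≡⟨ +-assoc (r * ℓ) _ (weight i) ⟨
        r * ℓ + (length S′ + length W′) + weight i      ≤⟨ +-monoˡ-≤ (weight i) cost ⟩
        budget k + weight i                             ∎

    module Nz = Neighbours (monochromatic-star-neighbours {G = G} simple z (c i) (star i)
                              (distinctE i) (centred i) (monochrome i))

    N : List (Fin n)
    N = take r Nz.list

    N-via-star : All (λ w → ∃[ j ] (j ∈ₗ star i × Joins G j z w)) N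
    N-via-star = All.take⁺ r Nz.via

    N-cover : r ≤ length N + (r ∸ deg i)
    N-cover = subst (λ d → r ≤ length N + (r ∸ d)) Nz.count (length-take-cover r Nz.list)

    neighbours : Terminals k
    neighbours = record
      { elems = N
      ; distinct = Unique.take⁺ r Nz.distinct
      ; ⊆R = All.map (λ { (j , j∈ , jo) → star-earlier i j _ j∈ jo }) N-via-star
      ; size≥1 = subst (1 ≤_) (sym (length-take r Nz.list))
                   (⊓-glb (≤-trans (s≤s z≤n) r≥2) (subst (1 ≤_) (sym Nz.count) (nonempty i)))
      ; size≤r = subst (_≤ r) (sym (length-take r Nz.list)) (m⊓n≤m r _) }

    extend-by-star : ∀ {j a b ℓ} → j ∈ₗ star i →
      RainbowPath G (｛ z ｝ ∪ InR< k) (｛ col j ｝ ∪ InC< k) a b ℓ →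
      RainbowPath G (InR< (suc k)) (InC< (suc k)) a b ℓ
    extend-by-star j∈ = RainbowPath-map
      (λ { (inj₁ refl) → z∈R ; (inj₂ v∈R) → InR<-suc v∈R })
      (λ { (inj₁ refl) → inj₂ (i , ≤-refl , sym (All.lookup (monochrome i) j∈))
         ; (inj₂ d∈C) → InC<-suc d∈C })

    colj∉C : ∀ {j} → j ∈ₗ star i → ¬ InC< k (col j)
    colj∉C j∈ = ci∉C ∘ subst (InC< k) (All.lookup (monochrome i) j∈)

    suc≤+weight : ∀ a → suc a ≤ a + weight i
    suc≤+weight a = ≤-trans (≤-reflexive (+-comm 1 a)) (+-monoʳ-≤ a (s≤s z≤n))

    module _ (S W : Terminals (suc k)) where

      link-via-X : z ∈ X → Link (suc k) (elems S) (elems W)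
      link-via-X z∈X = Link-lift
        (ih (restrict S (InR<-pred-X z∈X ∘ All.lookup (⊆R S)))
            (restrict W (InR<-pred-X z∈X ∘ All.lookup (⊆R W))))
        id id (m≤m+n _ _)

      link-avoiding-z : z ∉ₗ elems S → z ∉ₗ elems W → Link (suc k) (elems S) (elems W)
      link-avoiding-z z∉S z∉W =
        Link-lift (ih (without-z S z∉S) (without-z W z∉W)) id id (m≤m+n _ _)

      link-at-z : z ∈ₗ elems S → z ∈ₗ elems W → Link (suc k) (elems S) (elems W)
      link-at-z z∈S z∈W =
        link z∈S z∈W (within-budget (suc k) z≤n (size≤r S) (size≤r W)) (RainbowPath-trivial z∈R)

      link-dropping-z-from-S : z ∈ₗ elems S → z ∉ₗ elems W → 2 ≤ length (elems S) →
        Link (suc k) (elems S) (elems W)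
      link-dropping-z-from-S z∈S z∉W 2≤|S| with drop-z S z∈S 2≤|S|
      ... | S′ , S′⊆S , |S|≡ =
        Link-lift (ih S′ (without-z W z∉W)) S′⊆S id
          (≤-trans (≤-reflexive (cong (_+ length (elems W)) |S|≡)) (suc≤+weight _))

      link-dropping-z-from-W : z ∉ₗ elems S → z ∈ₗ elems W → 2 ≤ length (elems W) →
        Link (suc k) (elems S) (elems W)
      link-dropping-z-from-W z∉S z∈W 2≤|W| with drop-z W z∈W 2≤|W|
      ... | W′ , W′⊆W , |W|≡ =
        Link-lift (ih (without-z S z∉S) W′) id W′⊆W
          (≤-trans (≤-reflexive (trans (cong (length (elems S) +_) |W|≡) (+-suc _ _)))
            (suc≤+weight _))

      link-from-z : z ∉ X → z ∈ₗ elems S → z ∉ₗ elems W → length (elems S) ≤ 1 →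
        Link (suc k) (elems S) (elems W)
      link-from-z z∉X z∈S z∉W |S|≤1 with ih neighbours (without-z W z∉W)
      ... | link n∈N w∈W cost p with All.lookup N-via-star n∈N
      ... | j , j∈ , jo =
        link z∈S w∈W
          (≤budget-suc (prepend-cost N-cover |S|≤1 cost))
          (extend-by-star j∈ (RainbowPath-∷ (z∉R z∉X) (colj∉C j∈) p jo))

      link-to-z : z ∉ X → z ∉ₗ elems S → z ∈ₗ elems W → length (elems W) ≤ 1 →
        Link (suc k) (elems S) (elems W)
      link-to-z z∉X z∉S z∈W |W|≤1 with ih (without-z S z∉S) neighbours
      ... | link s∈S n∈N cost p with All.lookup N-via-star n∈N
      ... | j , j∈ , jo =
        link s∈S z∈W
          (≤budget-suc (append-cost N-cover |W|≤1 cost))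
          (extend-by-star j∈ (RainbowPath-∷ʳ (z∉R z∉X) (colj∉C j∈) p (swap jo)))

    open DecMembership (Fin._≟_ {n}) using () renaming (_∈?_ to _∈ₗ?_)

    linked-suc : Linked (suc k)
    linked-suc S W with z ∈? X | z ∈ₗ? elems S | z ∈ₗ? elems W
    ... | yes z∈X | _       | _       = link-via-X S W z∈X
    ... | no _    | yes z∈S | yes z∈W = link-at-z S W z∈S z∈W
    ... | no _    | no z∉S  | no z∉W  = link-avoiding-z S W z∉S z∉W
    ... | no z∉X  | yes z∈S | no z∉W with length (elems S) ≤? 1
    ...   | yes |S|≤1 = link-from-z S W z∉X z∈S z∉W |S|≤1
    ...   | no |S|≰1  = link-dropping-z-from-S S W z∈S z∉W (≰⇒> |S|≰1)
    linked-suc S W | no z∉X | no z∉S | yes z∈W with length (elems W) ≤? 1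
    ...   | yes |W|≤1 = link-to-z S W z∉X z∉S z∈W |W|≤1
    ...   | no |W|≰1  = link-dropping-z-from-W S W z∉S z∈W (≰⇒> |W|≰1)

  linked : ∀ k → k ≤ m → Linked k
  linked zero    _     = linked-0
  linked (suc k) k+1≤m = subst (Linked ∘ suc) (toℕ-fromℕ< k+1≤m)
    (Step.linked-suc (fromℕ< k+1≤m)
      (subst Linked (sym (toℕ-fromℕ< k+1≤m)) (linked k (≤-trans (n≤1+n k) k+1≤m))))

  singleton : ∀ {v} → v ∈ X ⊎ ∃[ i ] v ≡ u i → Terminals m
  singleton {v} v∈R = record
    { elems = v ∷ [] ; distinct = [] ∷ [] ; ⊆R = R⇒InR< v∈R ∷ []
    ; size≥1 = ≤-refl ; size≤r = ≤-trans (s≤s z≤n) r≥2 }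
    where
    R⇒InR< : v ∈ X ⊎ ∃[ i ] v ≡ u i → InR< m v
    R⇒InR< (inj₁ v∈X)    = inj₁ v∈X
    R⇒InR< (inj₂ (i , eq)) = inj₂ (i , toℕ<n i , eq)

  linked-singletons : ∀ {a b} → a ∈ X ⊎ ∃[ i ] a ≡ u i → b ∈ X ⊎ ∃[ i ] b ≡ u i →
    ∃[ ℓ ] (r * ℓ + 2 ≤ budget m × RainbowPath G (InR< m) (InC< m) a b ℓ)
  linked-singletons a∈R b∈R with linked m ≤-refl (singleton a∈R) (singleton b∈R)
  ... | link (here refl) (here refl) cost p = _ , cost , p

  InR<⇒R : ∀ {v} → InR< m v → v ∈ X ⊎ ∃[ i ] v ≡ u i
  InR<⇒R (inj₁ v∈X)        = inj₁ v∈X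
  InR<⇒R (inj₂ (i , _ , eq)) = inj₂ (i , eq)

  InC<⇒C : ∀ {d} → InC< m d → d ∈ CX ⊎ InCM d
  InC<⇒C (inj₁ d∈CX)       = inj₁ d∈CX
  InC<⇒C (inj₂ (i , _ , eq)) = inj₂ (i , eq)

  cost-bound : ∀ ℓ → r * ℓ + 2 ≤ budget m → r * ℓ ≤ m + sumFin (λ i → r ∸ deg i) + r * (x + 2)
  cost-bound ℓ cost = +-cancelʳ-≤ 2 (r * ℓ) _ (begin
    r * ℓ + 2                                            ≤⟨ cost ⟩
    budget m                                             ≡⟨ cong (r * (x + 2) + 2 +_) total ⟩
    r * (x + 2) + 2 + (m + sumFin (λ i → r ∸ deg i))     ≡⟨ rearrange (r * (x + 2)) m _ ⟩
    m + sumFin (λ i → r ∸ deg i) + r * (x + 2) + 2       ∎)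
    where
    open ≤-Reasoning
    total : sumBelow m weight ≡ m + sumFin (λ i → r ∸ deg i)
    total = trans (sumBelow-all weight) (sumFin-suc (λ i → r ∸ deg i))
    rearrange : ∀ a m s → a + 2 + (m + s) ≡ m + s + a + 2
    rearrange = solve-∀

lemma3p1 : (r : ℕ) → r ≥ 2 →
    (n : ℕ) (G : ECGraph n) → Simple G →
    (∀ c → 2 ≤ classSize G c × classSize G c ≤ r) →
    (X : Subset n) (m : ℕ) (u : Fin m → Fin n) →
    (∀ i k → u i ≡ u k → i ≡ k) →
    (M : Galaxy G u) →
    (CX : Subset n) → (∀ c → c ∈ CX → InC G X c) →
    (x : ℕ) →
    (∀ i j w → j ∈ₗ Galaxy.star M i → Joins G j (u i) w →
       w ∈ X ⊎ ∃[ k ] (k < i × w ≡ u k)) →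
    (∀ c → c ∈ CX → ¬ Galaxy.InCM M c) →
    (∀ a b → a ∈ X → b ∈ X →
       ∃[ ℓ ] (ℓ ≤ x × RainbowPath G (_∈ X) (_∈ CX) a b ℓ)) →
    let InR : Fin n → Set
        InR v = v ∈ X ⊎ ∃[ i ] v ≡ u i
    in ∀ a b → InR a → InR b →
       ∃[ ℓ ] (r * ℓ ≤ m + sumFin (λ i → r ∸ Galaxy.deg M i) + r * (x + 2)
               × RainbowPath G InR (λ c → c ∈ CX ⊎ Galaxy.InCM M c) a b ℓ)
lemma3p1 r r≥2 n G simple _ X m u u-injective M CX _ x star-earlier CX-fresh X-linked a b a∈R b∈R =
  let ℓ , cost , p = linked-singletons a∈R b∈R
  in ℓ , cost-bound ℓ cost , RainbowPath-map InR<⇒R InC<⇒C p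
  where open Linkage r r≥2 n G simple X m u u-injective M CX x star-earlier CX-fresh X-linked
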